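{- Let $s \geq 2$ be an integer and let $\alpha, \beta$ be non-negative integers with $\alpha, \beta < 2^{s-1}$. Then: (1) $\binom{\alpha + 2^s}{\beta + 2^{s-1}} \equiv 2\binom{\alpha}{\beta} \pmod{4}$; (2) $\binom{\alpha + 2^s}{\beta + 2^{s}} \equiv \binom{\alpha}{\beta} \pmod{4}$; (3) $\binom{\alpha + 2^{s-1} + 2^s}{\beta + 2^{s-1}} \equiv \binom{\alpha + 2^{s-1}}{\beta + 2^{s-1}} + 2\binom{\alpha + 2^{s-1}}{\beta} \pmod{4}$; (4) $\binom{\alpha + 2^{s-1} + 2^s}{\beta + 2^{s}} \equiv \binom{\alpha + 2^{s-1}}{\beta} + 2\binom{\alpha + 2^{s-1}}{\beta + 2^{s-1}} \pmod{4}$; (5) $\binom{\alpha + 2^{s-1} + 2^s}{\beta + 2^{s-1} + 2^s} \equiv \binom{\alpha + 2^{s-1}}{\beta + 2^{s-1}} \pmod{4}$.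
   Context: $\binom{n}{k}=0$ when $k>n$. -}

module Defs where

-- Read coefficientwise, the theorem is about (1 + x)^(2^s) modulo 4.  Squaring
-- (1 + x)^N ≡ 1 + 2x^M + x^N gives (1 + x)^(2N) ≡ 1 + 2x^N + x^(2N) (mod 4),
-- the cross terms 2·2(…) vanishing, so by induction from (1 + x)^2 = 1 + 2x + x^2
-- we get (1 + x)^(2^s) ≡ 1 + 2x^(2^(s-1)) + x^(2^s).  Multiplying by (1 + x)^a
-- and comparing coefficients of x^k, each of the five congruences is this
-- expansion at a = α or α + 2^(s-1), where the bounds on α and β leave only the
-- displayed binomial coefficients nonzero.
module Submission where

open import Defs
open import Data.Nat using (ℕ; _+_; _*_; _^_; _≤_; _<_; _∸_; zero; suc; s≤s; z≤n; s≤s⁻¹)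
open import Data.Nat.DivMod using (_%_; %-distribˡ-+; [m+kn]%n≡m%n)
open import Data.Nat.Combinatorics using (_C_; k>n⇒nCk≡0; nCk+nC[k+1]≡[n+1]C[k+1])
open import Data.Nat.Properties
open import Data.Nat.Tactic.RingSolver using (solve-∀)
open import Data.Product using (_×_; _,_)
open import Level using (0ℓ)
open import Relation.Binary.Bundles using (Setoid)
open import Relation.Binary.PropositionalEquality
import Relation.Binary.Reasoning.Setoid as SetoidReasoning

-- A record rather than a synonym, so that unification can recover a and b.
infix 4 _≡₄_
record _≡₄_ (a b : ℕ) : Set where
  constructor mod₄
  field %4-≡ : a % 4 ≡ b % 4
open _≡₄_

≡₄-setoid : Setoid 0ℓ 0ℓ
≡₄-setoid = record
  { Carrier       = ℕ
  ; _≈_           = _≡₄_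
  ; isEquivalence = record
    { refl  = mod₄ refl
    ; sym   = λ (mod₄ p) → mod₄ (sym p)
    ; trans = λ (mod₄ p) (mod₄ q) → mod₄ (trans p q)
    }
  }

≡⇒≡₄ : ∀ {a b} → a ≡ b → a ≡₄ b
≡⇒≡₄ a≡b = mod₄ (cong (_% 4) a≡b)

+-cong-≡₄ : ∀ {a a′ b b′} → a ≡₄ a′ → b ≡₄ b′ → a + b ≡₄ a′ + b′
+-cong-≡₄ {a} {a′} {b} {b′} (mod₄ a≡a′) (mod₄ b≡b′) = mod₄ (begin
  (a + b) % 4              ≡⟨ %-distribˡ-+ a b 4 ⟩
  (a % 4 + b % 4) % 4      ≡⟨ cong₂ (λ x y → (x + y) % 4) a≡a′ b≡b′ ⟩
  (a′ % 4 + b′ % 4) % 4    ≡⟨ %-distribˡ-+ a′ b′ 4 ⟨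
  (a′ + b′) % 4            ∎)
  where open ≡-Reasoning

2*-cong-≡₄ : ∀ {a a′} → a ≡₄ a′ → 2 * a ≡₄ 2 * a′
2*-cong-≡₄ a≡a′ = +-cong-≡₄ a≡a′ (+-cong-≡₄ a≡a′ (mod₄ refl))

+*4-≡₄ : ∀ a b → a + b * 4 ≡₄ a
+*4-≡₄ a b = mod₄ ([m+kn]%n≡m%n a b 4)

-- shiftedC d a k is the coefficient of x^k in x^d (1 + x)^a, that is
-- a C (k ∸ d) when d ≤ k and 0 when k < d.
shiftedC : ℕ → ℕ → ℕ → ℕ
shiftedC zero    a k       = a C k
shiftedC (suc d) a zero    = 0
shiftedC (suc d) a (suc k) = shiftedC d a k

shiftedC-+ : ∀ d a k → shiftedC d a (k + d) ≡ a C k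
shiftedC-+ zero    a k = cong (a C_) (+-identityʳ k)
shiftedC-+ (suc d) a k rewrite +-suc k d = shiftedC-+ d a k

shiftedC-< : ∀ d a {k} → k < d → shiftedC d a k ≡ 0
shiftedC-< (suc d) a {zero}  _         = refl
shiftedC-< (suc d) a {suc k} (s≤s k<d) = shiftedC-< d a k<d

shiftedC-> : ∀ d a {k} → a + d < k → shiftedC d a k ≡ 0
shiftedC-> zero    a {k}     a+0<k = k>n⇒nCk≡0 (subst (_< k) (+-identityʳ a) a+0<k)
shiftedC-> (suc d) a {zero}  _     = refl
shiftedC-> (suc d) a {suc k} a+d<k =
  shiftedC-> d a (s≤s⁻¹ (subst (_< suc k) (+-suc a d) a+d<k))

-- (1 + x)^N ≡ 1 + 2x^M + x^N (mod 4), compared coefficientwise after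
-- multiplying by (1 + x)^a.
record Expansion₄ (N M : ℕ) : Set where
  constructor expansion₄
  field expand : ∀ a k → (a + N) C k ≡₄ a C k + 2 * shiftedC M a k + shiftedC N a k
open Expansion₄

expand-shifted : ∀ {N M} → Expansion₄ N M → ∀ d a k →
  shiftedC d (a + N) k ≡₄ shiftedC d a k + 2 * shiftedC (d + M) a k + shiftedC (d + N) a k
expand-shifted e zero    a k       = expand e a k
expand-shifted e (suc d) a zero    = mod₄ refl
expand-shifted e (suc d) a (suc k) = expand-shifted e d a k

pascal : ∀ n k → suc n C suc k ≡ n C k + n C suc k
pascal n k = sym (nCk+nC[k+1]≡[n+1]C[k+1] n k)

[2+a]Ck-expansion : ∀ a k →
  (2 + a) C k ≡ a C k + 2 * shiftedC 1 a k + shiftedC 2 a k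
[2+a]Ck-expansion a zero          = refl
[2+a]Ck-expansion a (suc zero)    = begin
  (2 + a) C 1       ≡⟨ pascal (suc a) 0 ⟩
  1 + (1 + a) C 1   ≡⟨ cong (1 +_) (pascal a 0) ⟩
  1 + (1 + a C 1)   ≡⟨ rearrange (a C 1) ⟩
  a C 1 + 2 * 1 + 0 ∎
  where
  open ≡-Reasoning
  rearrange : ∀ x → 1 + (1 + x) ≡ x + 2 * 1 + 0
  rearrange = solve-∀
[2+a]Ck-expansion a (suc (suc k)) = begin
  (2 + a) C (2 + k)
    ≡⟨ pascal (suc a) (suc k) ⟩
  (1 + a) C (1 + k) + (1 + a) C (2 + k)
    ≡⟨ cong₂ _+_ (pascal a k) (pascal a (suc k)) ⟩
  (a C k + a C (1 + k)) + (a C (1 + k) + a C (2 + k))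
    ≡⟨ rearrange (a C k) (a C (1 + k)) (a C (2 + k)) ⟩
  a C (2 + k) + 2 * (a C (1 + k)) + a C k
    ∎
  where
  open ≡-Reasoning
  rearrange : ∀ x y z → (x + y) + (y + z) ≡ z + 2 * y + x
  rearrange = solve-∀

expansion₄-2-1 : Expansion₄ 2 1
expansion₄-2-1 = expansion₄ λ a k →
  ≡⇒≡₄ (trans (cong (_C k) (+-comm a 2)) ([2+a]Ck-expansion a k))

expansion₄-double : ∀ {N M} → Expansion₄ N M → Expansion₄ (N + N) N
expansion₄-double {N} {M} e = expansion₄ squared
  where
  squared : ∀ a k → (a + (N + N)) C k ≡₄ a C k + 2 * shiftedC N a k + shiftedC (N + N) a k
  squared a k = begin
      (a + (N + N)) C k
        ≡⟨ cong (_C k) (+-assoc a N N) ⟨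
      (a + N + N) C k
        ≈⟨ expand e (a + N) k ⟩
      (a + N) C k + 2 * shiftedC M (a + N) k + shiftedC N (a + N) k
        ≈⟨ +-cong-≡₄ (+-cong-≡₄ (expand e a k) (2*-cong-≡₄ (expand-shifted e M a k)))
                     (expand-shifted e N a k) ⟩
      (c + 2 * p + q) + 2 * (p + 2 * u + r) + (q + 2 * shiftedC (N + M) a k + t)
        ≡⟨ cong (λ r′ → (c + 2 * p + q) + 2 * (p + 2 * u + r) + (q + 2 * r′ + t))
                (cong (λ d → shiftedC d a k) (+-comm N M)) ⟩
      (c + 2 * p + q) + 2 * (p + 2 * u + r) + (q + 2 * r + t)
        ≡⟨ rearrange c p q u r t ⟩
      c + 2 * q + t + (p + u + r) * 4
        ≈⟨ +*4-≡₄ (c + 2 * q + t) (p + u + r) ⟩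
      c + 2 * q + t ∎
      where
      open SetoidReasoning ≡₄-setoid
      c p q u r t : ℕ
      c = a C k
      p = shiftedC M a k
      q = shiftedC N a k
      u = shiftedC (M + M) a k
      r = shiftedC (M + N) a k
      t = shiftedC (N + N) a k
      rearrange : ∀ c p q u r t → (c + 2 * p + q) + 2 * (p + 2 * u + r) + (q + 2 * r + t)
                                  ≡ c + 2 * q + t + (p + u + r) * 4
      rearrange = solve-∀

2^[1+n]≡2^n+2^n : ∀ n → 2 ^ suc n ≡ 2 ^ n + 2 ^ n
2^[1+n]≡2^n+2^n n = cong (2 ^ n +_) (+-identityʳ (2 ^ n))

expansion₄-2^ : ∀ t → Expansion₄ (2 ^ suc t) (2 ^ t)
expansion₄-2^ zero    = expansion₄-2-1
expansion₄-2^ (suc t) =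
  subst (λ N → Expansion₄ N (2 ^ suc t)) (sym (2^[1+n]≡2^n+2^n (suc t)))
    (expansion₄-double (expansion₄-2^ t))

expansion₄-at : ∀ {N M} → Expansion₄ N M → ∀ a k {c p r} →
  a C k ≡ c → shiftedC M a k ≡ p → shiftedC N a k ≡ r → (a + N) C k ≡₄ c + 2 * p + r
expansion₄-at e a k refl refl refl = expand e a k

expansion₄-cases : ∀ {N M α β} → Expansion₄ N M → N ≡ M + M → α < M → β < M →
    (α + N) C (β + M) ≡₄ 2 * (α C β)
  × (α + N) C (β + N) ≡₄ α C β
  × (α + M + N) C (β + M) ≡₄ (α + M) C (β + M) + 2 * ((α + M) C β)
  × (α + M + N) C (β + N) ≡₄ (α + M) C β + 2 * ((α + M) C (β + M))
  × (α + M + N) C (β + M + N) ≡₄ (α + M) C (β + M)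
expansion₄-cases {M = M} {α} {β} e refl α<M β<M =
    ≡₄-trans (expansion₄-at e α (β + M) (k>n⇒nCk≡0 α<β+M) (shiftedC-+ M α β)
               (shiftedC-< (M + M) α β+M<M+M))
             (≡⇒≡₄ (+-identityʳ _))
  , expansion₄-at e α (β + (M + M)) (k>n⇒nCk≡0 α<β+[M+M])
      (shiftedC-> M α α+M<β+[M+M]) (shiftedC-+ (M + M) α β)
  , ≡₄-trans (expansion₄-at e (α + M) (β + M) refl (shiftedC-+ M (α + M) β)
               (shiftedC-< (M + M) (α + M) β+M<M+M))
             (≡⇒≡₄ (+-identityʳ _))
  , ≡₄-trans (expansion₄-at e (α + M) (β + (M + M)) (k>n⇒nCk≡0 α+M<β+[M+M])
               (trans (cong (shiftedC M (α + M)) (sym (+-assoc β M M))) (shiftedC-+ M (α + M) (β + M)))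
               (shiftedC-+ (M + M) (α + M) β))
             (≡⇒≡₄ (+-comm (2 * ((α + M) C (β + M))) _))
  , expansion₄-at e (α + M) (β + M + (M + M))
      (k>n⇒nCk≡0 (m+n≤o⇒m≤o (suc (α + M)) α+M+M<β+M+[M+M]))
      (shiftedC-> M (α + M) α+M+M<β+M+[M+M]) (shiftedC-+ (M + M) (α + M) (β + M))
  where
  open Setoid ≡₄-setoid using () renaming (trans to ≡₄-trans)
  α<β+M : α < β + M
  α<β+M = <-≤-trans α<M (m≤n+m M β)
  β+M<M+M : β + M < M + M
  β+M<M+M = +-monoˡ-< M β<M
  α+M<β+[M+M] : α + M < β + (M + M)
  α+M<β+[M+M] = <-≤-trans (+-monoˡ-< M α<M) (m≤n+m (M + M) β)
  α<β+[M+M] : α < β + (M + M)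
  α<β+[M+M] = m+n≤o⇒m≤o (suc α) α+M<β+[M+M]
  α+M+M<β+M+[M+M] : α + M + M < β + M + (M + M)
  α+M+M<β+M+[M+M] = begin-strict
    α + M + M       ≡⟨ +-assoc α M M ⟩
    α + (M + M)     <⟨ +-monoˡ-< (M + M) α<M ⟩
    M + (M + M)     ≤⟨ +-monoˡ-≤ (M + M) (m≤n+m M β) ⟩
    β + M + (M + M) ∎
    where open ≤-Reasoning

lemma3p6 : ∀ (s α β : ℕ) → 2 ≤ s → α < 2 ^ (s ∸ 1) → β < 2 ^ (s ∸ 1) →
    ((α + 2 ^ s) C (β + 2 ^ (s ∸ 1))) % 4 ≡ (2 * (α C β)) % 4
    × ((α + 2 ^ s) C (β + 2 ^ s)) % 4 ≡ (α C β) % 4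
    × ((α + 2 ^ (s ∸ 1) + 2 ^ s) C (β + 2 ^ (s ∸ 1))) % 4
    ≡ ((α + 2 ^ (s ∸ 1)) C (β + 2 ^ (s ∸ 1)) + 2 * ((α + 2 ^ (s ∸ 1)) C β)) % 4
    × ((α + 2 ^ (s ∸ 1) + 2 ^ s) C (β + 2 ^ s)) % 4
    ≡ ((α + 2 ^ (s ∸ 1)) C β + 2 * ((α + 2 ^ (s ∸ 1)) C (β + 2 ^ (s ∸ 1)))) % 4
    × ((α + 2 ^ (s ∸ 1) + 2 ^ s) C (β + 2 ^ (s ∸ 1) + 2 ^ s)) % 4
    ≡ ((α + 2 ^ (s ∸ 1)) C (β + 2 ^ (s ∸ 1))) % 4
lemma3p6 (suc (suc t)) α β (s≤s (s≤s z≤n)) α<M β<M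
  with expansion₄-cases (expansion₄-2^ (suc t)) (2^[1+n]≡2^n+2^n (suc t)) α<M β<M
... | c₁ , c₂ , c₃ , c₄ , c₅ = %4-≡ c₁ , %4-≡ c₂ , %4-≡ c₃ , %4-≡ c₄ , %4-≡ c₅
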